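{- For every fixed $d\in\mathbb{N}$, $\chi^f_\star(\{\boxtimes_d P_n: n\in\mathbb{N}\})=1$.
   Context: $P_n$ is the $n$-vertex path and $\boxtimes_d P_n$ the $d$-fold strong product $P_n\boxtimes\cdots\boxtimes P_n$ (strong product: vertex set $V(A)\times V(B)$; distinct $(v,x),(w,y)$ adjacent iff ($v=w$, $xy\in E(B)$) or ($x=y$, $vw\in E(A)$) or ($vw\in E(A)$, $xy\in E(B)$)). A $(p\!:\!q)$-colouring assigns each vertex a $q$-subset of $p$ colours; it is a fractional $t$-colouring if $p/q\le t$. It has clustering $c$ if for every colour, each connected component of the subgraph induced by the vertices whose set contains that colour has at most $c$ vertices. $\chi^f_\star(\mathcal{G})$ is the infimum of $t\in\mathbb{R}$ such that for some $c\in\mathbb{N}$ every graph in $\mathcal{G}$ has a fractional $t$-colouring with clustering $c$. -}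

module Defs where

open import Data.Nat using (ℕ; zero; suc; _≤_; NonZero)
open import Data.Fin using (Fin; toℕ)
open import Data.Fin.Subset using (Subset; _∈_; ∣_∣)
open import Data.Integer using (+_)
open import Data.Rational using (ℚ; _/_) renaming (_≤_ to _≤ℚ_)
open import Data.Product using (_×_; Σ)
open import Data.Sum using (_⊎_)
open import Data.Unit using (⊤)
open import Data.Empty using (⊥)
open import Data.List using (List; length)
open import Data.List.Relation.Unary.All using (All)
open import Data.List.Relation.Unary.Unique.Propositional using (Unique)
open import Relation.Binary.PropositionalEquality using (_≡_)
open import Relation.Nullary using (¬_)

record Graph : Set₁ where
  field
    V   : Set
    Adj : V → V → Set
open Graph public

Path : ℕ → Graph
Path n = record
  { V   = Fin n
  ; Adj = λ x y → (toℕ y ≡ suc (toℕ x)) ⊎ (toℕ x ≡ suc (toℕ y)) }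

K1 : Graph
K1 = record { V = ⊤ ; Adj = λ _ _ → ⊥ }

_⊠_ : Graph → Graph → Graph
A ⊠ B = record
  { V   = V A × V B
  ; Adj = λ { (v , x) (w , y) →
        ¬ ((v , x) ≡ (w , y)) ×
        ( ((v ≡ w) × Adj B x y)
        ⊎ ((x ≡ y) × Adj A v w)
        ⊎ (Adj A v w × Adj B x y)) } }
  where open import Data.Product using (_,_)

⊠^ : ℕ → Graph → Graph
⊠^ zero    G = K1
⊠^ (suc d) G = (⊠^ d G) ⊠ G

data Reach (G : Graph) {p : ℕ} (col : V G → Subset p) (i : Fin p) (v : V G)
     : V G → Set where
  here : i ∈ col v → Reach G col i v v
  step : ∀ {u w} → Reach G col i v u → Adj G u w → i ∈ col w → Reach G col i v w

-- Clustering c: every monochromatic component has at most c vertices,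
-- i.e. every list of distinct vertices in the colour-i component of v
-- has length ≤ c.
HasClustering : (G : Graph) {p : ℕ} → (V G → Subset p) → ℕ → Set
HasClustering G col c =
  ∀ i (v : V G) (xs : List (V G)) →
    Unique xs → All (Reach G col i v) xs → length xs ≤ c

IsColouring : (G : Graph) (p q : ℕ) → (V G → Subset p) → Set
IsColouring G p q col = ∀ v → ∣ col v ∣ ≡ q

record FracColouring (G : Graph) (t : ℚ) (c : ℕ) : Set where
  field
    p q        : ℕ
    {{q≢0}}    : NonZero q
    col        : V G → Subset p
    colouring  : IsColouring G p q col
    ratio      : (+ p) / q ≤ℚ t
    clustering : HasClustering G col c

Admissible : ℕ → ℚ → Set
Admissible d t = Σ ℕ λ c → ∀ n → FracColouring (⊠^ d (Path n)) t c

module Submission where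

-- Give the vertex u of P_n all m colours except u mod m: an (m : m − 1)-colouring. A walk of
-- colour j never passes a vertex ≡ j (mod m), and every m consecutive vertices contain one, so a
-- colour-j component stays within distance m of each of its vertices and has at most 2m of them.
-- In a strong product, colour (i , j) is given to (v , x) when v has i and x has j; components then
-- project into products of components, so ⊠_d P_n gets an (m^d : (m − 1)^d)-colouring with
-- clustering (2m)^d, and by Bernoulli's inequality (m / (m − 1))^d drops below any t > 1 once m is
-- large. Conversely q ≤ p for every (p : q)-colouring, so no t < 1 is admissible.

open import Defs
open import Data.Bool using (true; _∧_)
open import Data.Bool.Properties using (∧-conicalˡ; ∧-conicalʳ)
open import Data.Nat hiding (_/_)
open import Data.Nat.Properties
open import Data.Nat.DivMod using (_mod_; m<n⇒m%n≡m; [m+n]%n≡m%n)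
open import Data.Nat.Tactic.RingSolver using (solve-∀)
open import Data.Fin using (Fin; zero; suc; toℕ; combine; remQuot)
import Data.Fin.Properties as Fin
open import Data.Fin.Subset using (Subset; inside; outside; ⊤; ⊥; ∁; ⁅_⁆; ∣_∣; _∈_)
open import Data.Fin.Subset.Properties using (∣⊥∣≡0; ∣∁p∣≡n∸∣p∣; ∣⁅x⁆∣≡1; ∣p∣≤n; x∈∁p⇒x∉p; x∈⁅x⁆)
open import Data.Vec using ([]; _∷_; _++_; lookup)
open import Data.Vec.Properties using (lookup-++ˡ; lookup-++ʳ; lookup-replicate; []=⇒lookup; lookup⇒[]=)
open import Data.List as List using (List; length)
open import Data.List.Membership.Propositional.Properties using (∈-lookup)
open import Data.List.Relation.Unary.All as All using (All)
open import Data.List.Relation.Unary.AllPairs using (_∷_)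
open import Data.List.Relation.Unary.Unique.Propositional using (Unique)
open import Data.Integer as ℤ using (+_; +≤+)
import Data.Integer.Properties as ℤ
open import Data.Rational as ℚ using (ℚ; 1ℚ; _/_; ↥_; ↧_; ↧ₙ_)
import Data.Rational.Properties as ℚ
import Data.Rational.Unnormalised as ℚᵘ
import Data.Rational.Unnormalised.Properties as ℚᵘ
open import Data.Product using (∃-syntax; _×_; _,_; proj₁; proj₂)
open import Data.Sum using (_⊎_; inj₁; inj₂)
open import Data.Unit using (tt)
open import Data.Empty using (⊥-elim)
open import Relation.Nullary using (¬_; yes; no)
open import Relation.Binary.PropositionalEquality

lookup-injective : ∀ {A : Set} {xs : List A} → Unique xs →
                   ∀ i j → List.lookup xs i ≡ List.lookup xs j → i ≡ j
lookup-injective (_ ∷ _)  zero    zero    _  = refl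
lookup-injective (x≢ ∷ _) zero    (suc j) eq = ⊥-elim (All.lookup x≢ (∈-lookup j) eq)
lookup-injective (x≢ ∷ _) (suc i) zero    eq = ⊥-elim (All.lookup x≢ (∈-lookup i) (sym eq))
lookup-injective (_ ∷ u)  (suc i) (suc j) eq = cong suc (lookup-injective u i j eq)

Unique⇒length≤ : ∀ {A : Set} {P : A → Set} {c} {xs : List A} (f : A → Fin c) →
                 (∀ {x y} → P x → P y → f x ≡ f y → x ≡ y) →
                 Unique xs → All P xs → length xs ≤ c
Unique⇒length≤ {xs = xs} f f-injective unique all-P = ≮⇒≥ λ c<length →
  let (i , j , i<j , fᵢ≡fⱼ) = Fin.pigeonhole c<length (λ k → f (List.lookup xs k))
  in Fin.<⇒≢ i<j (lookup-injective unique i j (f-injective (P-at i) (P-at j) fᵢ≡fⱼ))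
  where
  P-at = λ k → All.lookup all-P (∈-lookup k)

record ClusteredColouring (G : Graph) (p q c : ℕ) : Set where
  field
    colours         : V G → Subset p
    colours-size    : IsColouring G p q colours
    label           : Fin p → V G → V G → Fin c
    label-injective : ∀ {i v w w′} → Reach G colours i v w → Reach G colours i v w′ →
                      label i v w ≡ label i v w′ → w ≡ w′

  hasClustering : HasClustering G colours c
  hasClustering i v xs = Unique⇒length≤ (label i v) label-injective

open ClusteredColouring

K1-colouring : ClusteredColouring K1 1 1 1
K1-colouring .colours _ = ⊤
K1-colouring .colours-size _ = refl
K1-colouring .label _ _ _ = zero
K1-colouring .label-injective _ _ _ = refl

infixr 7 _⊗_

_⊗_ : ∀ {p m} → Subset p → Subset m → Subset (p * m)
[]            ⊗ t = []
(inside ∷ s)  ⊗ t = t ++ s ⊗ t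
(outside ∷ s) ⊗ t = ⊥ ++ s ⊗ t

∣++∣ : ∀ {p m} (s : Subset p) (t : Subset m) → ∣ s ++ t ∣ ≡ ∣ s ∣ + ∣ t ∣
∣++∣ []            t = refl
∣++∣ (inside ∷ s)  t = cong suc (∣++∣ s t)
∣++∣ (outside ∷ s) t = ∣++∣ s t

∣⊗∣ : ∀ {p m} (s : Subset p) (t : Subset m) → ∣ s ⊗ t ∣ ≡ ∣ s ∣ * ∣ t ∣
∣⊗∣ []            t = refl
∣⊗∣ (inside ∷ s)  t = trans (∣++∣ t (s ⊗ t)) (cong (_+_ ∣ t ∣) (∣⊗∣ s t))
∣⊗∣ {m = m} (outside ∷ s) t =
  trans (∣++∣ (⊥ {m}) (s ⊗ t)) (cong₂ _+_ (∣⊥∣≡0 m) (∣⊗∣ s t))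

lookup-⊗ : ∀ {p m} (s : Subset p) (t : Subset m) i j →
           lookup (s ⊗ t) (combine i j) ≡ lookup s i ∧ lookup t j
lookup-⊗ (inside ∷ s) t zero j = lookup-++ˡ t (s ⊗ t) j
lookup-⊗ {m = m} (outside ∷ s) t zero j =
  trans (lookup-++ˡ (⊥ {m}) (s ⊗ t) j) (lookup-replicate j outside)
lookup-⊗ (inside ∷ s) t (suc i) j = trans (lookup-++ʳ t (s ⊗ t) (combine i j)) (lookup-⊗ s t i j)
lookup-⊗ {m = m} (outside ∷ s) t (suc i) j =
  trans (lookup-++ʳ (⊥ {m}) (s ⊗ t) (combine i j)) (lookup-⊗ s t i j)

∈-⊗⁻ : ∀ {p m} (s : Subset p) (t : Subset m) k → k ∈ s ⊗ t →
       proj₁ (remQuot {p} m k) ∈ s × proj₂ (remQuot {p} m k) ∈ t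
∈-⊗⁻ {p} {m} s t k k∈s⊗t =
  lookup⇒[]= i s (∧-conicalˡ _ _ sᵢ∧tⱼ) , lookup⇒[]= j t (∧-conicalʳ _ _ sᵢ∧tⱼ)
  where
  i = proj₁ (remQuot {p} m k)
  j = proj₂ (remQuot {p} m k)
  sᵢ∧tⱼ : lookup s i ∧ lookup t j ≡ true
  sᵢ∧tⱼ = begin
    lookup s i ∧ lookup t j      ≡⟨ lookup-⊗ s t i j ⟨
    lookup (s ⊗ t) (combine i j) ≡⟨ cong (lookup (s ⊗ t)) (Fin.combine-remQuot {p} m k) ⟩
    lookup (s ⊗ t) k             ≡⟨ []=⇒lookup k∈s⊗t ⟩
    true                         ∎
    where open ≡-Reasoning

module _ {G H : Graph} {p q c p′ q′ c′ : ℕ}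
         (A : ClusteredColouring G p q c) (B : ClusteredColouring H p′ q′ c′) where

  ⊠-colours : V (G ⊠ H) → Subset (p * p′)
  ⊠-colours (v , x) = colours A v ⊗ colours B x

  reach-⊠ : ∀ {k v x w y} → Reach (G ⊠ H) ⊠-colours k (v , x) (w , y) →
            Reach G (colours A) (proj₁ (remQuot {p} p′ k)) v w ×
            Reach H (colours B) (proj₂ (remQuot {p} p′ k)) x y
  reach-⊠ {k} {v} {x} (here k∈) =
    let (i∈ , j∈) = ∈-⊗⁻ (colours A v) (colours B x) k k∈ in here i∈ , here j∈
  reach-⊠ {k} {w = w} {y} (step {_ , _} R (_ , adj) k∈)
    with reach-⊠ R | ∈-⊗⁻ (colours A w) (colours B y) k k∈ | adj
  ... | RG , RH | _  , j∈ | inj₁ (refl , x~y)        = RG , step RH x~y j∈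
  ... | RG , RH | i∈ , _  | inj₂ (inj₁ (refl , v~w)) = step RG v~w i∈ , RH
  ... | RG , RH | i∈ , j∈ | inj₂ (inj₂ (v~w , x~y))  = step RG v~w i∈ , step RH x~y j∈

  ⊠-colouring : ClusteredColouring (G ⊠ H) (p * p′) (q * q′) (c * c′)
  ⊠-colouring .colours = ⊠-colours
  ⊠-colouring .colours-size (v , x) =
    trans (∣⊗∣ (colours A v) (colours B x)) (cong₂ _*_ (colours-size A v) (colours-size B x))
  ⊠-colouring .label k (v , x) (w , y) =
    let (i , j) = remQuot {p} p′ k in combine (label A i v w) (label B j x y)
  ⊠-colouring .label-injective R R′ eq with reach-⊠ R | reach-⊠ R′
  ... | RG , RH | RG′ , RH′ =
    let (eqᴬ , eqᴮ) = Fin.combine-injective _ _ _ _ eq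
    in cong₂ _,_ (label-injective A RG RG′ eqᴬ) (label-injective B RH RH′ eqᴮ)

resize : ∀ {G p q c p′ q′ c′} → p ≡ p′ → q ≡ q′ → c ≡ c′ →
         ClusteredColouring G p q c → ClusteredColouring G p′ q′ c′
resize refl refl refl A = A

⊠^-colouring : ∀ {G p q c} → ClusteredColouring G p q c → ∀ d →
               ClusteredColouring (⊠^ d G) (p ^ d) (q ^ d) (c ^ d)
⊠^-colouring A zero = K1-colouring
⊠^-colouring {p = p} {q} {c} A (suc d) =
  resize (*-comm (p ^ d) p) (*-comm (q ^ d) q) (*-comm (c ^ d) c) (⊠-colouring (⊠^-colouring A d) A)

Between : ℕ → ℕ → ℕ → Set
Between x y w = (x ≤ w × w ≤ y) ⊎ (y ≤ w × w ≤ x)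

Between-sym : ∀ {x y w} → Between x y w → Between y x w
Between-sym (inj₁ b) = inj₂ b
Between-sym (inj₂ b) = inj₁ b

Between-self : ∀ {x w} → Between x x w → w ≡ x
Between-self (inj₁ (x≤w , w≤x)) = ≤-antisym w≤x x≤w
Between-self (inj₂ (x≤w , w≤x)) = ≤-antisym w≤x x≤w

Between-step : ∀ {x u u′ w} → u′ ≡ suc u ⊎ u ≡ suc u′ → Between x u′ w → w ≢ u′ → Between x u w
Between-step (inj₁ refl) (inj₁ (x≤w , w≤u′)) w≢u′ = inj₁ (x≤w , ≤-pred (≤∧≢⇒< w≤u′ w≢u′))
Between-step (inj₂ refl) (inj₁ (x≤w , w≤u′)) _    = inj₁ (x≤w , m≤n⇒m≤1+n w≤u′)
Between-step (inj₁ refl) (inj₂ (u′≤w , w≤x)) _    = inj₂ (≤-trans (n≤1+n _) u′≤w , w≤x)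
Between-step (inj₂ refl) (inj₂ (u′≤w , w≤x)) w≢u′ = inj₂ (≤∧≢⇒< u′≤w (≢-sym w≢u′) , w≤x)

residue-in-window : ∀ {a} (j : Fin (suc a)) x → ∃[ w ] x ≤ w × w < x + suc a × w % suc a ≡ toℕ j
residue-in-window j zero = toℕ j , z≤n , Fin.toℕ<n j , m<n⇒m%n≡m (Fin.toℕ<n j)
residue-in-window {a} j (suc x) with residue-in-window j x
... | w , x≤w , w<x+m , w≡j with w ≟ x
...   | yes refl = w + suc a , subst (suc w ≤_) (sym (+-suc w a)) (s≤s (m≤m+n w a)) , ≤-refl ,
                   trans ([m+n]%n≡m%n w (suc a)) w≡j
...   | no w≢x   = w , ≤∧≢⇒< x≤w (≢-sym w≢x) , m≤n⇒m≤1+n w<x+m , w≡j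

window-avoiding-residue : ∀ {a} (j : Fin (suc a)) {x y} →
                          (∀ w → Between x y w → w % suc a ≢ toℕ j) → y < x + suc a
window-avoiding-residue j {x} avoids = ≰⇒> λ x+m≤y →
  let (w , x≤w , w<x+m , w≡j) = residue-in-window j x
  in avoids w (inj₁ (x≤w , ≤-trans (<⇒≤ w<x+m) x+m≤y)) w≡j

module _ (n a : ℕ) where

  pathColours : Fin n → Subset (suc a)
  pathColours u = ∁ ⁅ toℕ u mod suc a ⁆

  ∈-pathColours⁻ : ∀ {i} u → i ∈ pathColours u → toℕ u % suc a ≢ toℕ i
  ∈-pathColours⁻ {i} u i∈ u≡i =
    x∈∁p⇒x∉p i∈ (subst (_∈ ⁅ toℕ u mod suc a ⁆) u-mod≡i (x∈⁅x⁆ _))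
    where
    u-mod≡i = Fin.toℕ-injective (trans (Fin.toℕ-fromℕ< _) u≡i)

  reach-avoids : ∀ {i v u} → Reach (Path n) pathColours i v u →
                 ∀ w → Between (toℕ v) (toℕ u) w → w % suc a ≢ toℕ i
  reach-avoids {v = v} (here i∈) w b rewrite Between-self b = ∈-pathColours⁻ v i∈
  reach-avoids (step {w = u′} R u~u′ i∈) w b with w ≟ toℕ u′
  ... | yes refl = ∈-pathColours⁻ u′ i∈
  ... | no w≢u′  = reach-avoids R w (Between-step u~u′ b w≢u′)

  reach-near : ∀ {i v u} → Reach (Path n) pathColours i v u →
               toℕ u < toℕ v + suc a × toℕ v < toℕ u + suc a
  reach-near {i} {v} {u} R =
    window-avoiding-residue i {toℕ v} {toℕ u} (reach-avoids R) ,
    window-avoiding-residue i {toℕ u} {toℕ v} (λ w b → reach-avoids R w (Between-sym b))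

  offset : Fin n → Fin n → ℕ
  offset v u = toℕ u + suc a ∸ toℕ v

  pathLabel : Fin n → Fin n → Fin (suc a + suc a)
  pathLabel v u = offset v u mod (suc a + suc a)

  -- No wrap-around happens on a component: its vertices lie strictly within distance suc a of v.
  toℕ-pathLabel : ∀ {i v u} → Reach (Path n) pathColours i v u → toℕ (pathLabel v u) ≡ offset v u
  toℕ-pathLabel {v = v} {u} R =
    trans (Fin.toℕ-fromℕ< _) (m<n⇒m%n≡m (m<n+o⇒m∸n<o (toℕ u + suc a) (toℕ v) u+m<v+2m))
    where
    u+m<v+2m : toℕ u + suc a < toℕ v + (suc a + suc a)
    u+m<v+2m = subst (toℕ u + suc a <_) (+-assoc (toℕ v) (suc a) (suc a))
                     (+-monoˡ-< (suc a) (proj₁ (reach-near R)))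

  pathLabel-injective : ∀ {i v u u′} →
                        Reach (Path n) pathColours i v u → Reach (Path n) pathColours i v u′ →
                        pathLabel v u ≡ pathLabel v u′ → u ≡ u′
  pathLabel-injective {u = u} {u′} R R′ eq =
    Fin.toℕ-injective (+-cancelʳ-≡ (suc a) (toℕ u) (toℕ u′) (∸-cancelʳ-≡
      (<⇒≤ (proj₂ (reach-near R))) (<⇒≤ (proj₂ (reach-near R′)))
      (trans (sym (toℕ-pathLabel R)) (trans (cong toℕ eq) (toℕ-pathLabel R′)))))

  pathColouring : ClusteredColouring (Path n) (suc a) a (suc a + suc a)
  pathColouring .colours = pathColours
  pathColouring .colours-size u = trans (∣∁p∣≡n∸∣p∣ ⁅ r ⁆) (cong (suc a ∸_) (∣⁅x⁆∣≡1 r))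
    where r = toℕ u mod suc a
  pathColouring .label _ = pathLabel
  pathColouring .label-injective = pathLabel-injective

-- (1 − 1/(a+1))^k ≥ 1 − k/(a+1), multiplied through by (a+1)^(k+1).
bernoulli : ∀ a k → suc a ^ k * suc a ≤ a ^ k * suc a + k * suc a ^ k
bernoulli a zero = m≤m+n _ 0
bernoulli a (suc k) = begin
  m * X * m                        ≡⟨ cong (_* m) (*-comm m X) ⟩
  X * m * m                        ≤⟨ *-monoˡ-≤ m (bernoulli a k) ⟩
  (Y * m + k * X) * m              ≡⟨ expand Y X a k ⟩
  a * Y * m + k * (m * X) + Y * m  ≤⟨ +-monoʳ-≤ (a * Y * m + k * (m * X)) (*-monoˡ-≤ m Y≤X) ⟩
  a * Y * m + k * (m * X) + X * m  ≡⟨ collect Y X a k ⟩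
  a * Y * m + suc k * (m * X)      ∎
  where
  open ≤-Reasoning
  m = suc a
  X = suc a ^ k
  Y = a ^ k
  Y≤X : Y ≤ X
  Y≤X = ^-monoˡ-≤ k (n≤1+n a)
  expand : ∀ Y X a k → (Y * suc a + k * X) * suc a ≡ a * Y * suc a + k * (suc a * X) + Y * suc a
  expand = solve-∀
  collect : ∀ Y X a k →
            a * Y * suc a + k * (suc a * X) + X * suc a ≡ a * Y * suc a + suc k * (suc a * X)
  collect = solve-∀

power-ratio-≤ : ∀ {a d D} → d * suc D ≤ a → suc a ^ d * D ≤ suc D * a ^ d
power-ratio-≤ {_} {d} {D} d[1+D]≤a with r , refl ← m≤n⇒∃[o]m+o≡n d[1+D]≤a =
  *-cancelʳ-≤ _ _ e (begin
    X * D * e        ≡⟨ swap X D e ⟩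
    X * e * D        ≤⟨ *-monoˡ-≤ D Xe≤Ym ⟩
    Y * m * D        ≡⟨ *-assoc Y m D ⟩
    Y * (m * D)      ≤⟨ *-monoʳ-≤ Y mD≤[1+D]e ⟩
    Y * (suc D * e)  ≡⟨ *-assoc Y (suc D) e ⟨
    Y * suc D * e    ≡⟨ cong (_* e) (*-comm Y (suc D)) ⟩
    suc D * Y * e    ∎)
  where
  open ≤-Reasoning
  m = suc (d * suc D + r)
  e = suc (d * D + r)
  X = m ^ d
  Y = (d * suc D + r) ^ d
  swap : ∀ x y z → x * y * z ≡ x * z * y
  swap = solve-∀
  m≡d+e : ∀ d D r → suc (d * suc D + r) ≡ d + suc (d * D + r)
  m≡d+e = solve-∀
  Xe≤Ym : X * e ≤ Y * m
  Xe≤Ym = +-cancelˡ-≤ (d * X) _ _ (begin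
    d * X + X * e   ≡⟨ cong (_+ X * e) (*-comm d X) ⟩
    X * d + X * e   ≡⟨ *-distribˡ-+ X d e ⟨
    X * (d + e)     ≡⟨ cong (X *_) (m≡d+e d D r) ⟨
    X * m           ≤⟨ bernoulli (d * suc D + r) d ⟩
    Y * m + d * X   ≡⟨ +-comm (Y * m) (d * X) ⟩
    d * X + Y * m   ∎)
  mD≤[1+D]e : m * D ≤ suc D * e
  mD≤[1+D]e = begin
    m * D          ≡⟨ cong (_* D) (m≡d+e d D r) ⟩
    (d + e) * D    ≡⟨ *-distribʳ-+ D d e ⟩
    d * D + e * D  ≤⟨ +-monoˡ-≤ (e * D) (m≤n⇒m≤1+n (m≤m+n (d * D) r)) ⟩
    e + e * D      ≡⟨ cong (_+_ e) (*-comm e D) ⟩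
    suc D * e      ∎

*≤*⇒/≤/ : ∀ i j n k .{{_ : NonZero n}} .{{_ : NonZero k}} →
          i ℤ.* + k ℤ.≤ j ℤ.* + n → i / n ℚ.≤ j / k
*≤*⇒/≤/ i j (suc n) (suc k) i*k≤j*n = ℚ.toℚᵘ-cancel-≤
  (ℚᵘ.≤-respʳ-≃ (ℚᵘ.≃-sym (ℚ.toℚᵘ-fromℚᵘ (ℚᵘ.mkℚᵘ j k)))
    (ℚᵘ.≤-respˡ-≃ (ℚᵘ.≃-sym (ℚ.toℚᵘ-fromℚᵘ (ℚᵘ.mkℚᵘ i n))) (ℚᵘ.*≤* i*k≤j*n)))

1≤/ : ∀ p q .{{_ : NonZero q}} → q ≤ p → 1ℚ ℚ.≤ + p / q
1≤/ p q q≤p = *≤*⇒/≤/ (+ 1) (+ p) 1 q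
  (subst₂ ℤ._≤_ (sym (ℤ.*-identityˡ (+ q))) (sym (ℤ.*-identityʳ (+ p))) (+≤+ q≤p))

/≤-if-1< : ∀ {t} p q .{{_ : NonZero q}} → 1ℚ ℚ.< t →
           p * ↧ₙ t ≤ suc (↧ₙ t) * q → + p / q ℚ.≤ t
/≤-if-1< {t} p q 1<t p↧t≤[1+↧t]q =
  subst (+ p / q ℚ.≤_) (ℚ.↥p/↧p≡p t) (*≤*⇒/≤/ (+ p) (↥ t) q (↧ₙ t) (begin
    + p ℤ.* ↧ t            ≡⟨ ℤ.pos-* p (↧ₙ t) ⟨
    + (p * ↧ₙ t)           ≤⟨ +≤+ p↧t≤[1+↧t]q ⟩
    + (suc (↧ₙ t) * q)     ≡⟨ ℤ.pos-* (suc (↧ₙ t)) q ⟩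
    + suc (↧ₙ t) ℤ.* + q   ≤⟨ ℤ.*-monoʳ-≤-nonNeg (+ q) 1+↧t≤↥t ⟩
    ↥ t ℤ.* + q            ∎))
  where
  open ℤ.≤-Reasoning
  1+↧t≤↥t : + suc (↧ₙ t) ℤ.≤ ↥ t
  1+↧t≤↥t = ℤ.i<j⇒suc[i]≤j
    (subst₂ ℤ._<_ (ℤ.*-identityˡ (↧ t)) (ℤ.*-identityʳ (↥ t)) (ℚ.drop-*<* 1<t))

fracColouring : ∀ {G p q c t} {{_ : NonZero q}} → ClusteredColouring G p q c →
                + p / q ℚ.≤ t → FracColouring G t c
fracColouring {p = p} {q} A p/q≤t = record
  { p = p ; q = q ; col = colours A ; colouring = colours-size A
  ; ratio = p/q≤t ; clustering = hasClustering A }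

fracColouring⇒1≤t : ∀ {G t c} → V G → FracColouring G t c → 1ℚ ℚ.≤ t
fracColouring⇒1≤t v χ = ℚ.≤-trans (1≤/ p q q≤p) ratio
  where
  open FracColouring χ
  q≤p : q ≤ p
  q≤p = subst (_≤ p) (colouring v) (∣p∣≤n (col v))

corner : ∀ d → V (⊠^ d (Path 1))
corner zero = tt
corner (suc d) = corner d , zero

mainTheorem12 : ∀ (d : ℕ) →
    (∀ (t : ℚ) → 1ℚ ℚ.< t → Admissible d t) × (∀ (t : ℚ) → t ℚ.< 1ℚ → ¬ Admissible d t)
mainTheorem12 d = above-1 , below-1
  where
  above-1 : ∀ t → 1ℚ ℚ.< t → Admissible d t
  above-1 t 1<t = (suc a + suc a) ^ d , λ n →
    fracColouring {{m^n≢0 a d}} (⊠^-colouring (pathColouring n a) d)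
      (/≤-if-1< (suc a ^ d) (a ^ d) {{m^n≢0 a d}} 1<t (power-ratio-≤ {a} {d} (n≤1+n _)))
    where a = suc (d * suc (↧ₙ t))
  below-1 : ∀ t → t ℚ.< 1ℚ → ¬ Admissible d t
  below-1 t t<1 (_ , χ) = ℚ.<-irrefl refl (ℚ.≤-<-trans (fracColouring⇒1≤t (corner d) (χ 1)) t<1)
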